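{- Let $\mathcal{G}=(\mathsf{Ac},\mathsf{V},\mathsf{E},\ell,\sim_a)$ be a concurrent game structure and let $a$ be an agent. Let $(\chi,\mathrm{I},\rho)$ be an $a$-consistent state with a truthful information perspective $\mathrm{I}$. Then for each history $\rho'$ such that $\rho \sim_a \rho'$ and $\rho'$ is consistent with $\chi$ under $\mathrm{I}_a$, we have $(\chi,\mathrm{I},\rho) \trianglelefteq_a (\chi,\mathrm{I},\rho')$.
   Context: Fix a finite set of agents $\mathsf{Ag}$ and a countable set of propositions $\mathsf{Prop}$. A concurrent game structure is a tuple $(\mathsf{Ac},\mathsf{V},\mathsf{E},\ell,\sim_a)$ with a finite set of actions $\mathsf{Ac}$, a finite set of positions $\mathsf{V}$, a transition function $\mathsf{E}:\mathsf{V}\times\mathsf{Ac}^{\mathsf{Ag}}\to\mathsf{V}$, a valuation $\ell:\mathsf{V}\to\mathcal{P}(\mathsf{Prop})$, and for each agent $a$ an equivalence relation $\sim_a \subseteq (\mathsf{V}\times\mathsf{V})\cup(\mathsf{Ac}\times\mathsf{Ac})$. A joint action is a map $\alpha:\mathsf{Ag}\to\mathsf{Ac}$; $\alpha\sim_a\beta$ iff $\alpha(b)\sim_a\beta(b)$ for all agents $b$. A history is a sequence $\rho=v_0\alpha_1v_1\ldots\alpha_nv_n$ with $\mathsf{E}(v_i,\alpha_{i+1})=v_{i+1}$; $\rho_{\le i}=v_0\alpha_1\ldots\alpha_iv_i$. Two histories $\rho=v_0\alpha_1\ldots\alpha_nv_n$, $\rho'=v'_0\alpha'_1\ldots\alpha'_mv'_m$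 satisfy $\rho\sim_a\rho'$ iff $m=n$, $v_i\sim_a v'_i$ for all $i\le n$, and $\alpha_i\sim_a\alpha'_i$ for all $1\le i\le n$. A strategy is a function from histories to actions; an assignment $\chi$ maps agents to strategies. A history $\rho$ is consistent with $\chi$ for a set of agents $X$ if $\alpha_{i+1}(b)=\chi(b)(\rho_{\le i})$ for all $i<n$ and $b\in X$. Let $\mathsf{Ag}^{*}$ be finite words over $\mathsf{Ag}$ without adjacent repeated letters and $\mathsf{Ag}^{\geq 2}$ those of length at least 2. An information perspective is a set $\mathrm{I}\subseteq\mathsf{Ag}^{\geq2}$; $\mathrm{I}_a:=\{b\mid ab\in\mathrm{I}\}\cup\{a\}$ and $\mathrm{I}[a]:=\{w\in\mathsf{Ag}^{\geq2}\mid aw\in\mathrm{I}\}\cup\{w\in\mathrm{I}\mid w=aw' \text{ for some } w'\}$. $\mathrm{I}$ is truthful if $aw\in\mathrm{I}$ implies $w\in\mathrm{I}$ for all agents $a$ and $w\in\mathsf{Ag}^{\geq2}$ (which implies $\mathrm{I}[a]\subseteq\mathrm{I}$). Assignments satisfy $\chi\sim^{\mathrm{I}}_a\chi'$ iff $\chi(b)=\chi'(b)$ for all $b\in\mathrm{I}_a$. A state is a triple $(\chi,\mathrm{I},\rho)$ of an assignment, an information perspective and a history; it is $a$-consistent if $\rho$ is consistent with $\chi$ under $\mathrm{I}_a$. We write $(\chi,\mathrm{I},\rho)\trianglelefteq_a(\chi',\mathrm{I}',\rho')$ iff $\chi\sim^{\mathrm{I}}_a\chi'$, $\mathrm{I}[a]\subseteq\mathrm{I}'$,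 $\rho\sim_a\rho'$, and both states are $a$-consistent. -}

module Defs where

open import Data.Nat using (ℕ; _≤_)
open import Data.Fin using (Fin)
open import Data.Bool using (Bool)
open import Data.List using (List; []; _∷_; length)
open import Data.Product using (_×_; _,_)
open import Data.Sum using (_⊎_)
open import Data.Unit using (⊤)
open import Data.Empty using (⊥)
open import Relation.Nullary using (¬_)
open import Relation.Binary.PropositionalEquality using (_≡_)
open import Relation.Binary.Structures using (IsEquivalence)

-- Agents: a finite set, represented as Fin nAg.
-- Propositions: a countable set, represented as ℕ.
Prop : Set
Prop = ℕ

-- The relation ∼_a on (V×V) ∪ (Ac×Ac) is given as two relations
-- (one on positions, one on actions), each an equivalence relation.
record CGS (nAg : ℕ) : Set₁ where
  field
    nAc   : ℕ
    nV    : ℕ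
    E     : Fin nV → (Fin nAg → Fin nAc) → Fin nV
    ℓ     : Fin nV → Prop → Bool
    simV  : Fin nAg → Fin nV → Fin nV → Set
    simAc : Fin nAg → Fin nAc → Fin nAc → Set
    simV-equiv  : ∀ a → IsEquivalence (simV a)
    simAc-equiv : ∀ a → IsEquivalence (simAc a)

module Game {nAg : ℕ} (G : CGS nAg) where
  open CGS G

  Ag : Set
  Ag = Fin nAg

  Ac : Set
  Ac = Fin nAc

  V : Set
  V = Fin nV

  JointAction : Set
  JointAction = Ag → Ac

  _∼J[_]_ : JointAction → Ag → JointAction → Set
  α ∼J[ a ] β = ∀ b → simAc a (α b) (β b)

  data History : Set
  last : History → V

  data History where
    start : V → History
    step  : (h : History) (α : JointAction) (v : V) → E (last h) α ≡ v → History

  last (start v)        = v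
  last (step _ _ v _)   = v

  data _∼H[_]_ : History → Ag → History → Set where
    start∼ : ∀ {a v v'} → simV a v v' → start v ∼H[ a ] start v'
    step∼  : ∀ {a h h' α α' v v' e e'} →
             h ∼H[ a ] h' → α ∼J[ a ] α' → simV a v v' →
             step h α v e ∼H[ a ] step h' α' v' e'

  Strategy : Set
  Strategy = History → Ac

  Assignment : Set
  Assignment = Ag → Strategy

  ConsistentFor : Assignment → (Ag → Set) → History → Set
  ConsistentFor χ X (start v)       = ⊤
  ConsistentFor χ X (step h α v _)  = ConsistentFor χ X h × (∀ b → X b → α b ≡ χ b h)

  Word : Set
  Word = List Ag

  NoAdjRep : Word → Set
  NoAdjRep []               = ⊤
  NoAdjRep (x ∷ [])         = ⊤
  NoAdjRep (x ∷ y ∷ w)      = ¬ (x ≡ y) × NoAdjRep (y ∷ w)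

  InAg≥2 : Word → Set
  InAg≥2 w = NoAdjRep w × (2 ≤ length w)

  InfoPersp : Set₁
  InfoPersp = Word → Set

  IsInfoPersp : InfoPersp → Set
  IsInfoPersp I = ∀ w → I w → InAg≥2 w

  Iₐ : InfoPersp → Ag → (Ag → Set)
  Iₐ I a b = I (a ∷ b ∷ []) ⊎ b ≡ a

  I[_] : InfoPersp → Ag → InfoPersp
  I[_] I a w = (InAg≥2 w × I (a ∷ w)) ⊎ (I w × StartsWith w)
    where
      StartsWith : Word → Set
      StartsWith []      = ⊥
      StartsWith (x ∷ _) = x ≡ a

  Truthful : InfoPersp → Set
  Truthful I = ∀ a w → InAg≥2 w → I (a ∷ w) → I w

  SimAssign : InfoPersp → Ag → Assignment → Assignment → Set
  SimAssign I a χ χ' = ∀ b → (Iₐ I a) b → χ b ≡ χ' b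

  record State : Set₁ where
    constructor ⟨_,_,_⟩
    field
      χ  : Assignment
      I  : InfoPersp
      ρ  : History

  Consistent : Ag → State → Set
  Consistent a ⟨ χ , I , ρ ⟩ = ConsistentFor χ (Iₐ I a) ρ

  _⊆_ : InfoPersp → InfoPersp → Set
  J ⊆ K = ∀ w → J w → K w

  _⊴[_]_ : State → Ag → State → Set
  s ⊴[ a ] s' =
    SimAssign (State.I s) a (State.χ s) (State.χ s')
    × (I[ State.I s ] a ⊆ State.I s')
    × (State.ρ s ∼H[ a ] State.ρ s')
    × Consistent a s
    × Consistent a s'

{-# OPTIONS --safe #-}
module Submission where

open import Defs
open import Data.Nat using (ℕ)
open import Data.Sum using (inj₁; inj₂)
open import Data.Product using (_,_)
open import Relation.Binary.PropositionalEquality using (refl)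

module _ {nAg : ℕ} (G : CGS nAg) where
  open Game G

  SimAssign-refl : ∀ I a χ → SimAssign I a χ χ
  SimAssign-refl I a χ b _ = refl

  Truthful⇒I[a]⊆I : ∀ {I} → Truthful I → ∀ a → I[ I ] a ⊆ I
  Truthful⇒I[a]⊆I truthful a w (inj₁ (w∈Ag≥2 , aw∈I)) = truthful a w w∈Ag≥2 aw∈I
  Truthful⇒I[a]⊆I truthful a w (inj₂ (w∈I , _))       = w∈I

lemma1 : ∀ {nAg : ℕ} (G : CGS nAg) (a : Game.Ag G)
    (χ : Game.Assignment G) (I : Game.InfoPersp G) (ρ : Game.History G) →
    Game.IsInfoPersp G I →
    Game.Truthful G I →
    Game.Consistent G a (Game.⟨_,_,_⟩ χ I ρ) →
    (ρ' : Game.History G) →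
    Game._∼H[_]_ G ρ a ρ' →
    Game.ConsistentFor G χ (Game.Iₐ G I a) ρ' →
    Game._⊴[_]_ G (Game.⟨_,_,_⟩ χ I ρ) a (Game.⟨_,_,_⟩ χ I ρ')
lemma1 G a χ I ρ _ truthful consistent ρ' ρ∼ρ' consistent' =
  SimAssign-refl G I a χ , Truthful⇒I[a]⊆I G truthful a , ρ∼ρ' , consistent , consistent'
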